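{- Let $\mu=(\mathrm{Val},(\mathcal P,\mathcal O),\varsigma)$ be a model with $\mathrm{Val}=\{0,0.5,1\}$ for the predicate symbols $\mathrm{input},\mathrm{echo}_1,\mathrm{echo}_2,\mathrm{output}$, whose semitopology $(\mathcal P,\mathcal O)$ is 3-twined, and suppose every axiom of $\mathrm{ThyCA}$ is valid in $\mu$. Then $$\models\mathsf{Everywhere}\,\exists v.\,\mathrm{output}(v).$$
   Context: Truth values: $\mathbf 3=\{\mathbf f,\mathbf b,\mathbf t\}$ totally ordered by $\mathbf f<\mathbf b<\mathbf t$; $\wedge,\vee$ are min and max, $\bigwedge,\bigvee$ are infimum and supremum. Negation: $\neg\mathbf t=\mathbf f$, $\neg\mathbf b=\mathbf b$, $\neg\mathbf f=\mathbf t$. Modalities: $\mathsf T x=\mathbf t$ if $x=\mathbf t$, else $\mathbf f$; $\mathsf B x=\mathbf t$ if $x=\mathbf b$, else $\mathbf f$; $\mathsf{TF}x=\mathbf t$ if $x\in\{\mathbf t,\mathbf f\}$, else $\mathbf f$. Weak implication $x\to_w y:=\neg x\vee y$; strong implication $x\to_s y:=\neg x\vee\mathsf T y$. Exclusive-or: $x\oplus y=\mathbf b$ if $x=\mathbf b$ or $y=\mathbf b$; otherwise $\mathbf t$ if $x\neq y$ and $\mathbf f$ if $x=y$. A truth value is valid iff it lies in $\{\mathbf t,\mathbf b\}$. A semitopology $(\mathcal P,\mathcal O)$ is a set $\mathcal P$ with a family $\mathcal O$ of subsets containing $\mathcal P$ and closed under arbitrary (including empty) unions; $\mathcal O^{\neq\emptyset}$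 is the set of nonempty members. It is 3-twined if any three members of $\mathcal O^{\neq\emptyset}$ have nonempty intersection. For $f:\mathcal P\to\mathbf 3$: $\mathsf{Everywhere} f=\bigwedge_{p}f(p)$, $\mathsf{Somewhere} f=\bigvee_p f(p)$, $\mathsf{Quorum} f=\bigvee_{O\in\mathcal O^{\neq\emptyset}}\bigwedge_{p\in O}f(p)$, $\mathsf{Contraquorum} f=\bigwedge_{O\in\mathcal O^{\neq\emptyset}}\bigvee_{p\in O}f(p)$. Logic: a model $\mu=(\mathrm{Val},(\mathcal P,\mathcal O),\varsigma)$ consists of a nonempty set $\mathrm{Val}$, a semitopology, and for each predicate symbol $R$ a function $\varsigma(R):\mathcal P\to\mathrm{Val}\to\mathbf 3$. Formulas are built from atoms $R(t)$, value equalities $v\doteq v'$ (denoting $\mathbf t$ if $v=v'$, else $\mathbf f$), connectives $\neg,\wedge,\vee,\to_w,\to_s,\oplus$, modalities $\mathsf T,\mathsf B,\mathsf{TF}$, operators $\mathsf{Everywhere},\mathsf{Somewhere},\mathsf{Quorum},\mathsf{Contraquorum}$ and quantifiers over $\mathrm{Val}$. Denotation $[\![\phi]\!]:\mathcal P\to\mathbf 3$: $[\![R(v)]\!](p)=\varsigma(R)(p)(v)$; connectives and modalities act pointwise in $p$; $[\![\mathsf{Quorum}\,\phi]\!](p)=\mathsf{Quorum}([\![\phi]\!])$ for all $p$, likewise for the other three operators; $[\![\exists a.\phi]\!](p)=\bigvee_{v}[\![\phi[a:=v]]\!](p)$, $[\![\forall a.\phi]\!](p)=\bigwedge_{v}[\![\phi[a:=v]]\!](p)$;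 $[\![\exists_{01}a.\phi]\!](p)=\bigwedge_{v,v'}\big(([\![\phi[a:=v]]\!](p)\wedge[\![\phi[a:=v']]\!](p))\to_w (v\doteq v')\big)$. $p\models\phi$ iff $[\![\phi]\!](p)\in\{\mathbf t,\mathbf b\}$; $\models\phi$ iff $p\models\phi$ for all $p$. $\mathrm{correct}(R):=\forall a.\mathsf{TF}R(a)$, $\mathrm{incorrect}(R):=\forall a.\mathsf B R(a)$, $\mathrm{correct}(R_1,\dots,R_n):=\bigwedge_i\mathrm{correct}(R_i)$. Axioms with a free variable $a$ are universally quantified over $a$; an axiom is valid in $\mu$ if $\models$ it. $\mathrm{ThyCA}$ (with $\mathrm{Val}=\{0,0.5,1\}$) consists of: CaEcho1?: $\mathrm{echo}_1(a)\to_s\mathsf{Somewhere}\,\mathrm{input}(a)$; CaEcho2?: $\mathrm{echo}_2(a)\to_w\mathsf{Quorum}\,\mathrm{echo}_1(a)$; CaOutput?: $(\mathrm{output}(0)\to_w\mathsf{Quorum}\,\mathrm{echo}_2(0))\wedge(\mathrm{output}(1)\to_w\mathsf{Quorum}\,\mathrm{echo}_2(1))$; CaOutput'?: $\mathrm{output}(0.5)\to_w(\mathsf{Quorum}\,\mathrm{echo}_1(0)\wedge\mathsf{Quorum}\,\mathrm{echo}_1(1))$; CaCorrect: $\mathsf{Quorum}\,\mathrm{correct}(\mathrm{input},\mathrm{echo}_1,\mathrm{echo}_2,\mathrm{output})$; CaCorrect': $\mathrm{correct}(R)\vee\mathrm{incorrect}(R)$ for each $R\in\{\mathrm{input},\mathrm{echo}_1,\mathrm{echo}_2,\mathrm{output}\}$;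 CaInput: $(\mathrm{input}(0)\oplus\mathrm{input}(1))\wedge\neg\mathrm{input}(0.5)$; CaEcho2$_{01}$: $\exists_{01}a.\mathrm{echo}_2(a)$; CaEcho1!: $(\mathrm{input}(a)\vee\mathsf{Contraquorum}\,\mathrm{echo}_1(a))\to_w\mathrm{echo}_1(a)$; CaEcho2!: $(\exists a.\mathsf{Quorum}\,\mathrm{echo}_1(a))\to_w\exists a.\mathrm{echo}_2(a)$; CaOutput!: $\mathsf{Quorum}\,\mathrm{echo}_2(a)\to_w\mathrm{output}(a)$; CaOutput'!: $(\mathsf{Quorum}\,\mathrm{echo}_1(0)\wedge\mathsf{Quorum}\,\mathrm{echo}_1(1))\to_w\mathrm{output}(0.5)$. -}

module Defs where

open import Level using (Level; 0ℓ) renaming (suc to lsuc)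
open import Data.Unit using (⊤)
open import Data.Product using (Σ; ∃; _×_; _,_)
open import Data.Sum using (_⊎_)
open import Relation.Nullary using (Dec; yes; no)
open import Relation.Binary.PropositionalEquality using (_≡_)
open import Axiom.ExcludedMiddle using (ExcludedMiddle)

-- Three-valued truth values  f < b < t

data 𝟑 : Set where
  𝐟 𝐛 𝐭 : 𝟑

infixr 6 _∧₃_
infixr 5 _∨₃_

_∧₃_ : 𝟑 → 𝟑 → 𝟑
𝐟 ∧₃ y = 𝐟
𝐛 ∧₃ 𝐟 = 𝐟
𝐛 ∧₃ y = 𝐛
𝐭 ∧₃ y = y

_∨₃_ : 𝟑 → 𝟑 → 𝟑
𝐭 ∨₃ y = 𝐭
𝐛 ∨₃ 𝐭 = 𝐭
𝐛 ∨₃ y = 𝐛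
𝐟 ∨₃ y = y

¬₃ : 𝟑 → 𝟑
¬₃ 𝐭 = 𝐟
¬₃ 𝐛 = 𝐛
¬₃ 𝐟 = 𝐭

T₃ : 𝟑 → 𝟑
T₃ 𝐭 = 𝐭
T₃ _ = 𝐟

B₃ : 𝟑 → 𝟑
B₃ 𝐛 = 𝐭
B₃ _ = 𝐟

TF₃ : 𝟑 → 𝟑
TF₃ 𝐛 = 𝐟
TF₃ _ = 𝐭

_→w₃_ : 𝟑 → 𝟑 → 𝟑
x →w₃ y = ¬₃ x ∨₃ y

_→s₃_ : 𝟑 → 𝟑 → 𝟑
x →s₃ y = ¬₃ x ∨₃ T₃ y

_⊕₃_ : 𝟑 → 𝟑 → 𝟑
𝐛 ⊕₃ y = 𝐛
x ⊕₃ 𝐛 = 𝐛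
𝐭 ⊕₃ 𝐭 = 𝐟
𝐭 ⊕₃ 𝐟 = 𝐭
𝐟 ⊕₃ 𝐭 = 𝐭
𝐟 ⊕₃ 𝐟 = 𝐟

Valid : 𝟑 → Set
Valid x = x ≡ 𝐭 ⊎ x ≡ 𝐛

module _ {ℓ : Level} (lem : ExcludedMiddle ℓ) where

  ⋀ : {I : Set ℓ} → (I → 𝟑) → 𝟑
  ⋀ {I} f with lem {∃ λ (i : I) → f i ≡ 𝐟}
  ... | yes _ = 𝐟
  ... | no _ with lem {∃ λ (i : I) → f i ≡ 𝐛}
  ...   | yes _ = 𝐛
  ...   | no _ = 𝐭

  ⋁ : {I : Set ℓ} → (I → 𝟑) → 𝟑
  ⋁ {I} f with lem {∃ λ (i : I) → f i ≡ 𝐭}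
  ... | yes _ = 𝐭
  ... | no _ with lem {∃ λ (i : I) → f i ≡ 𝐛}
  ...   | yes _ = 𝐛
  ...   | no _ = 𝐟

record Semitopology (P : Set) : Set₁ where
  field
    Open   : (P → Set) → Set
    open-P : Open (λ _ → ⊤)
    open-⋃ : {I : Set} (U : I → P → Set) → (∀ i → Open (U i))
           → Open (λ p → ∃ λ i → U i p)

NonEmpty : {P : Set} → (P → Set) → Set
NonEmpty U = ∃ λ p → U p

ThreeTwined : {P : Set} → Semitopology P → Set₁
ThreeTwined {P} S =
  (U V W : P → Set) → Open U → Open V → Open W →
  NonEmpty U → NonEmpty V → NonEmpty W →
  ∃ λ p → U p × V p × W p
  where open Semitopology S

data Val : Set where
  v0 v½ v1 : Val

_≐_ : Val → Val → 𝟑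
v0 ≐ v0 = 𝐭
v½ ≐ v½ = 𝐭
v1 ≐ v1 = 𝐭
_  ≐ _  = 𝐟

⋀Val : (Val → 𝟑) → 𝟑
⋀Val f = f v0 ∧₃ f v½ ∧₃ f v1

⋁Val : (Val → 𝟑) → 𝟑
⋁Val f = f v0 ∨₃ f v½ ∨₃ f v1

record Model : Set₁ where
  field
    P      : Set
    top    : Semitopology P
    input  : P → Val → 𝟑
    echo₁  : P → Val → 𝟑
    echo₂  : P → Val → 𝟑
    output : P → Val → 𝟑

module Semantics (lem : ∀ {ℓ} → ExcludedMiddle ℓ) (μ : Model) where
  open Model μ
  open Semitopology top

  Den : Set
  Den = P → 𝟑

  ¬' : Den → Den
  ¬' φ p = ¬₃ (φ p)

  infixr 6 _∧'_
  infixr 5 _∨'_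
  infixr 4 _⊕'_
  infixr 3 _→w'_ _→s'_

  _∧'_ _∨'_ _→w'_ _→s'_ _⊕'_ : Den → Den → Den
  (φ ∧' ψ) p = φ p ∧₃ ψ p
  (φ ∨' ψ) p = φ p ∨₃ ψ p
  (φ →w' ψ) p = φ p →w₃ ψ p
  (φ →s' ψ) p = φ p →s₃ ψ p
  (φ ⊕' ψ) p = φ p ⊕₃ ψ p

  T' B' TF' : Den → Den
  T' φ p = T₃ (φ p)
  B' φ p = B₃ (φ p)
  TF' φ p = TF₃ (φ p)

  eq' : Val → Val → Den
  eq' v v' _ = v ≐ v'

  OpenNE : Set₁
  OpenNE = Σ (P → Set) λ U → Open U × NonEmpty U

  Everywhere Somewhere Quorum Contraquorum : Den → Den
  Everywhere φ _ = ⋀ lem {I = P} φ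
  Somewhere φ _ = ⋁ lem {I = P} φ
  Quorum φ _ =
    ⋁ lem {I = OpenNE} λ { (U , _) → ⋀ lem {I = Σ P U} λ { (p , _) → φ p } }
  Contraquorum φ _ =
    ⋀ lem {I = OpenNE} λ { (U , _) → ⋁ lem {I = Σ P U} λ { (p , _) → φ p } }

  Exists Forall : (Val → Den) → Den
  Exists φ p = ⋁Val λ v → φ v p
  Forall φ p = ⋀Val λ v → φ v p

  Exists01 : (Val → Den) → Den
  Exists01 φ p =
    ⋀Val λ v → ⋀Val λ v' → (φ v p ∧₃ φ v' p) →w₃ (v ≐ v')

  Input Echo₁ Echo₂ Output : Val → Den
  Input  a p = input p a
  Echo₁  a p = echo₁ p a
  Echo₂  a p = echo₂ p a
  Output a p = output p a

  correct incorrect : (Val → Den) → Den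
  correct R = Forall λ a → TF' (R a)
  incorrect R = Forall λ a → B' (R a)

  ⊨_ : Den → Set
  ⊨ φ = ∀ p → Valid (φ p)

  -- all axioms of ThyCA are valid (free variable a universally quantified)
  record ThyCA : Set where
    field
      CaEcho1? : ⊨ Forall λ a → Echo₁ a →s' Somewhere (Input a)
      CaEcho2? : ⊨ Forall λ a → Echo₂ a →w' Quorum (Echo₁ a)
      CaOutput? : ⊨ ((Output v0 →w' Quorum (Echo₂ v0))
                     ∧' (Output v1 →w' Quorum (Echo₂ v1)))
      CaOutput'? : ⊨ (Output v½ →w' (Quorum (Echo₁ v0) ∧' Quorum (Echo₁ v1)))
      CaCorrect : ⊨ Quorum (correct Input ∧' correct Echo₁
                            ∧' correct Echo₂ ∧' correct Output)
      CaCorrect'-input  : ⊨ (correct Input ∨' incorrect Input)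
      CaCorrect'-echo₁  : ⊨ (correct Echo₁ ∨' incorrect Echo₁)
      CaCorrect'-echo₂  : ⊨ (correct Echo₂ ∨' incorrect Echo₂)
      CaCorrect'-output : ⊨ (correct Output ∨' incorrect Output)
      CaInput : ⊨ ((Input v0 ⊕' Input v1) ∧' ¬' (Input v½))
      CaEcho2₀₁ : ⊨ Exists01 Echo₂
      CaEcho1! : ⊨ Forall λ a →
                   (Input a ∨' Contraquorum (Echo₁ a)) →w' Echo₁ a
      CaEcho2! : ⊨ ((Exists λ a → Quorum (Echo₁ a)) →w' (Exists λ a → Echo₂ a))
      CaOutput! : ⊨ Forall λ a → Quorum (Echo₂ a) →w' Output a
      CaOutput'! : ⊨ ((Quorum (Echo₁ v0) ∧' Quorum (Echo₁ v1)) →w' Output v½)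

-- Let U be a nonempty open set on which all four predicates are correct. For a ∈ {0,1},
-- either Contraquorum echo₁(a) is true, and then by CaEcho1! echo₁(a) is true on all of U,
-- or echo₁(a) is nowhere true on some nonempty open W_a. Not both values can be avoided:
-- a point of U ∩ W₀ ∩ W₁ has a true input, which it echoes. If neither is avoided, output(0.5)
-- fires. If only b is avoided, each point of U has a true echo₂(a′), backed by a quorum of
-- echo₁(a′); 3-twinedness makes that quorum meet U ∩ W_b, so a′ ≠ b, and a′ ≠ 0.5 because
-- echo₁(0.5) needs an input 0.5 somewhere. Hence U is a quorum for echo₂(a), and output(a).
module Submission where

open import Data.Empty using (⊥; ⊥-elim)
open import Data.Product using (Σ; ∃; _×_; _,_; proj₁; proj₂)
open import Data.Sum using (_⊎_; inj₁; inj₂)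
open import Relation.Nullary using (¬_; yes; no)
open import Relation.Binary.PropositionalEquality using (_≡_; _≢_; refl; sym; trans; subst)
open import Axiom.ExcludedMiddle using (ExcludedMiddle)

open import Defs

𝐟≢𝐭 : 𝐟 ≢ 𝐭
𝐟≢𝐭 ()

𝐛≢𝐭 : 𝐛 ≢ 𝐭
𝐛≢𝐭 ()

¬Valid-𝐟 : ¬ Valid 𝐟
¬Valid-𝐟 (inj₁ ())
¬Valid-𝐟 (inj₂ ())

Valid-≢𝐟 : ∀ {x} → x ≢ 𝐟 → Valid x
Valid-≢𝐟 {𝐟} x≢𝐟 = ⊥-elim (x≢𝐟 refl)
Valid-≢𝐟 {𝐛} _   = inj₂ refl
Valid-≢𝐟 {𝐭} _   = inj₁ refl

∧₃-valid⁻ : ∀ x y → Valid (x ∧₃ y) → Valid x × Valid y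
∧₃-valid⁻ 𝐟 _ v = ⊥-elim (¬Valid-𝐟 v)
∧₃-valid⁻ 𝐛 𝐟 v = ⊥-elim (¬Valid-𝐟 v)
∧₃-valid⁻ 𝐛 𝐛 _ = inj₂ refl , inj₂ refl
∧₃-valid⁻ 𝐛 𝐭 _ = inj₂ refl , inj₁ refl
∧₃-valid⁻ 𝐭 _ v = inj₁ refl , v

∧₃-true⁺ : ∀ {x y} → x ≡ 𝐭 → y ≡ 𝐭 → x ∧₃ y ≡ 𝐭
∧₃-true⁺ refl refl = refl

∨₃-valid⁻ : ∀ x y → Valid (x ∨₃ y) → Valid x ⊎ Valid y
∨₃-valid⁻ 𝐭 _ _ = inj₁ (inj₁ refl)
∨₃-valid⁻ 𝐛 _ _ = inj₁ (inj₂ refl)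
∨₃-valid⁻ 𝐟 _ v = inj₂ v

∨₃-validˡ : ∀ {x} y → Valid x → Valid (x ∨₃ y)
∨₃-validˡ y (inj₁ refl) = inj₁ refl
∨₃-validˡ 𝐭 (inj₂ refl) = inj₁ refl
∨₃-validˡ 𝐛 (inj₂ refl) = inj₂ refl
∨₃-validˡ 𝐟 (inj₂ refl) = inj₂ refl

∨₃-validʳ : ∀ x {y} → Valid y → Valid (x ∨₃ y)
∨₃-validʳ 𝐭 _           = inj₁ refl
∨₃-validʳ 𝐛 (inj₁ refl) = inj₁ refl
∨₃-validʳ 𝐛 (inj₂ refl) = inj₂ refl
∨₃-validʳ 𝐟 v           = v

∨₃-trueˡ : ∀ {x} y → x ≡ 𝐭 → x ∨₃ y ≡ 𝐭
∨₃-trueˡ y refl = refl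

∨₃-trueʳ : ∀ x {y} → y ≡ 𝐭 → x ∨₃ y ≡ 𝐭
∨₃-trueʳ 𝐭 refl = refl
∨₃-trueʳ 𝐛 refl = refl
∨₃-trueʳ 𝐟 refl = refl

∨₃-true⁺ : ∀ {x y} → x ≡ 𝐭 ⊎ y ≡ 𝐭 → x ∨₃ y ≡ 𝐭
∨₃-true⁺ {y = y} (inj₁ x≡𝐭) = ∨₃-trueˡ y x≡𝐭
∨₃-true⁺ {x = x} (inj₂ y≡𝐭) = ∨₃-trueʳ x y≡𝐭

-- Only a true antecedent lets a valid weak implication be used: 𝐛 →w₃ 𝐟 = 𝐛.
→w₃-mp : ∀ {x y} → Valid (x →w₃ y) → x ≡ 𝐭 → Valid y
→w₃-mp v refl = v

→s₃-mp : ∀ {x y} → Valid (x →s₃ y) → x ≡ 𝐭 → y ≡ 𝐭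
→s₃-mp {y = 𝐭} _ refl = refl
→s₃-mp {y = 𝐛} v refl = ⊥-elim (¬Valid-𝐟 v)
→s₃-mp {y = 𝐟} v refl = ⊥-elim (¬Valid-𝐟 v)

¬₃-valid⇒≢𝐭 : ∀ {x} → Valid (¬₃ x) → x ≢ 𝐭
¬₃-valid⇒≢𝐭 v refl = ¬Valid-𝐟 v

TF₃-valid⇒valid⇒true : ∀ {x} → Valid (TF₃ x) → Valid x → x ≡ 𝐭
TF₃-valid⇒valid⇒true {𝐭} _ _ = refl
TF₃-valid⇒valid⇒true {𝐛} v _ = ⊥-elim (¬Valid-𝐟 v)
TF₃-valid⇒valid⇒true {𝐟} _ v = ⊥-elim (¬Valid-𝐟 v)

⊕₃-valid⇒true : ∀ x y → Valid (x ⊕₃ y) → Valid (TF₃ x) → Valid (TF₃ y) → x ≡ 𝐭 ⊎ y ≡ 𝐭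
⊕₃-valid⇒true 𝐭 _ _ _ _ = inj₁ refl
⊕₃-valid⇒true 𝐛 _ _ v _ = ⊥-elim (¬Valid-𝐟 v)
⊕₃-valid⇒true 𝐟 𝐭 _ _ _ = inj₂ refl
⊕₃-valid⇒true 𝐟 𝐛 _ _ v = ⊥-elim (¬Valid-𝐟 v)
⊕₃-valid⇒true 𝐟 𝐟 v _ _ = ⊥-elim (¬Valid-𝐟 v)

module _ {ℓ} (lem : ExcludedMiddle ℓ) {I : Set ℓ} (f : I → 𝟑) where

  ⋀-valid⁻ : Valid (⋀ lem f) → ∀ i → Valid (f i)
  ⋀-valid⁻ v i with lem {∃ λ i → f i ≡ 𝐟}
  ... | yes _   = ⊥-elim (¬Valid-𝐟 v)
  ... | no none = Valid-≢𝐟 λ fi≡𝐟 → none (i , fi≡𝐟)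

  ⋀-valid⁺ : (∀ i → Valid (f i)) → Valid (⋀ lem f)
  ⋀-valid⁺ valid with lem {∃ λ i → f i ≡ 𝐟}
  ... | yes (i , fi≡𝐟) = ⊥-elim (¬Valid-𝐟 (subst Valid fi≡𝐟 (valid i)))
  ... | no _ with lem {∃ λ i → f i ≡ 𝐛}
  ...   | yes _ = inj₂ refl
  ...   | no _  = inj₁ refl

  ⋀-true⁺ : (∀ i → f i ≡ 𝐭) → ⋀ lem f ≡ 𝐭
  ⋀-true⁺ true with lem {∃ λ i → f i ≡ 𝐟}
  ... | yes (i , fi≡𝐟) = ⊥-elim (𝐟≢𝐭 (trans (sym fi≡𝐟) (true i)))
  ... | no _ with lem {∃ λ i → f i ≡ 𝐛}
  ...   | yes (i , fi≡𝐛) = ⊥-elim (𝐛≢𝐭 (trans (sym fi≡𝐛) (true i)))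
  ...   | no _           = refl

  ⋀-not-true⁻ : ⋀ lem f ≢ 𝐭 → ∃ λ i → f i ≢ 𝐭
  ⋀-not-true⁻ ≢𝐭 with lem {∃ λ i → f i ≡ 𝐟}
  ... | yes (i , fi≡𝐟) = i , λ fi≡𝐭 → 𝐟≢𝐭 (trans (sym fi≡𝐟) fi≡𝐭)
  ... | no _ with lem {∃ λ i → f i ≡ 𝐛}
  ...   | yes (i , fi≡𝐛) = i , λ fi≡𝐭 → 𝐛≢𝐭 (trans (sym fi≡𝐛) fi≡𝐭)
  ...   | no _           = ⊥-elim (≢𝐭 refl)

  ⋁-true⁺ : ∀ i → f i ≡ 𝐭 → ⋁ lem f ≡ 𝐭
  ⋁-true⁺ i fi≡𝐭 with lem {∃ λ i → f i ≡ 𝐭}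
  ... | yes _   = refl
  ... | no none = ⊥-elim (none (i , fi≡𝐭))

  ⋁-true⁻ : ⋁ lem f ≡ 𝐭 → ∃ λ i → f i ≡ 𝐭
  ⋁-true⁻ ≡𝐭 with lem {∃ λ i → f i ≡ 𝐭}
  ... | yes witness = witness
  ... | no _ with lem {∃ λ i → f i ≡ 𝐛}
  ⋁-true⁻ () | no _ | yes _
  ⋁-true⁻ () | no _ | no _

  ⋁-valid⁻ : Valid (⋁ lem f) → ∃ λ i → Valid (f i)
  ⋁-valid⁻ v with lem {∃ λ i → f i ≡ 𝐭}
  ... | yes (i , fi≡𝐭) = i , inj₁ fi≡𝐭
  ... | no _ with lem {∃ λ i → f i ≡ 𝐛}
  ...   | yes (i , fi≡𝐛) = i , inj₂ fi≡𝐛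
  ...   | no _           = ⊥-elim (¬Valid-𝐟 v)

⋀Val-valid⁻ : ∀ f → Valid (⋀Val f) → ∀ v → Valid (f v)
⋀Val-valid⁻ f v v0 = proj₁ (∧₃-valid⁻ (f v0) _ v)
⋀Val-valid⁻ f v v½ = proj₁ (∧₃-valid⁻ (f v½) (f v1) (proj₂ (∧₃-valid⁻ (f v0) _ v)))
⋀Val-valid⁻ f v v1 = proj₂ (∧₃-valid⁻ (f v½) (f v1) (proj₂ (∧₃-valid⁻ (f v0) _ v)))

⋁Val-true⁺ : ∀ f v → f v ≡ 𝐭 → ⋁Val f ≡ 𝐭
⋁Val-true⁺ f v0 t = ∨₃-trueˡ _ t
⋁Val-true⁺ f v½ t = ∨₃-trueʳ (f v0) (∨₃-trueˡ _ t)
⋁Val-true⁺ f v1 t = ∨₃-trueʳ (f v0) (∨₃-trueʳ (f v½) t)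

⋁Val-valid⁺ : ∀ f v → Valid (f v) → Valid (⋁Val f)
⋁Val-valid⁺ f v0 v = ∨₃-validˡ _ v
⋁Val-valid⁺ f v½ v = ∨₃-validʳ (f v0) (∨₃-validˡ _ v)
⋁Val-valid⁺ f v1 v = ∨₃-validʳ (f v0) (∨₃-validʳ (f v½) v)

⋁Val-valid⁻ : ∀ f → Valid (⋁Val f) → ∃ λ v → Valid (f v)
⋁Val-valid⁻ f v with ∨₃-valid⁻ (f v0) _ v
... | inj₁ v₀ = v0 , v₀
... | inj₂ v′ with ∨₃-valid⁻ (f v½) (f v1) v′
...   | inj₁ v₁ = v½ , v₁
...   | inj₂ v₂ = v1 , v₂

module _ (lem : ∀ {ℓ} → ExcludedMiddle ℓ) (μ : Model) where
  open Model μ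
  open Semantics lem μ

  ThreeTwined-meet : ThreeTwined top → (U V W : OpenNE) →
                     ∃ λ p → proj₁ U p × proj₁ V p × proj₁ W p
  ThreeTwined-meet twined (U , oU , neU) (V , oV , neV) (W , oW , neW) =
    twined U V W oU oV oW neU neV neW

  Quorum-valid⁻ : ∀ φ p → Valid (Quorum φ p) → Σ OpenNE λ W → ∀ q → proj₁ W q → Valid (φ q)
  Quorum-valid⁻ φ p v with ⋁-valid⁻ lem _ v
  ... | W , vW = W , λ q q∈W → ⋀-valid⁻ lem _ vW (q , q∈W)

  Quorum-true⁺ : ∀ φ p (W : OpenNE) → (∀ q → proj₁ W q → φ q ≡ 𝐭) → Quorum φ p ≡ 𝐭
  Quorum-true⁺ φ p W true = ⋁-true⁺ lem _ W (⋀-true⁺ lem _ λ { (q , q∈W) → true q q∈W })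

  Contraquorum-not-true⁻ : ∀ φ p → Contraquorum φ p ≢ 𝐭 →
                           Σ OpenNE λ W → ∀ q → proj₁ W q → φ q ≢ 𝐭
  Contraquorum-not-true⁻ φ p ≢𝐭 with ⋀-not-true⁻ lem _ ≢𝐭
  ... | W , ≢𝐭W = W , λ q q∈W φq≡𝐭 → ≢𝐭W (⋁-true⁺ lem _ (q , q∈W) φq≡𝐭)

  Forall-valid⁻ : ∀ φ p → Valid (Forall φ p) → ∀ a → Valid (φ a p)
  Forall-valid⁻ φ p = ⋀Val-valid⁻ (λ a → φ a p)

  correct-valid⁻ : ∀ R p → Valid (correct R p) → ∀ a → Valid (TF₃ (R a p))
  correct-valid⁻ R p = Forall-valid⁻ (λ a → TF' (R a)) p

  correct-valid⇒true : ∀ R p → Valid (correct R p) → ∀ a → Valid (R a p) → R a p ≡ 𝐭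
  correct-valid⇒true R p c a = TF₃-valid⇒valid⇒true (correct-valid⁻ R p c a)

  Somewhere-true⁻ : ∀ φ p → Somewhere φ p ≡ 𝐭 → ∃ λ q → φ q ≡ 𝐭
  Somewhere-true⁻ φ p = ⋁-true⁻ lem φ

  -- Quorum and Contraquorum denote constant functions, so the point p₀ at which they are
  -- read below is immaterial.
  module _ (twined : ThreeTwined top) (thy : ThyCA) (p₀ : P) where
    open ThyCA thy

    AllCorrect : Den
    AllCorrect = correct Input ∧' correct Echo₁ ∧' correct Echo₂ ∧' correct Output

    correct-quorum : Σ OpenNE λ W → ∀ q → proj₁ W q → Valid (AllCorrect q)
    correct-quorum = Quorum-valid⁻ AllCorrect p₀ (CaCorrect p₀)

    U : OpenNE
    U = proj₁ correct-quorum

    U-correct : ∀ {q} → proj₁ U q →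
                Valid (correct Input q) × Valid (correct Echo₁ q) × Valid (correct Echo₂ q)
    U-correct {q} q∈U =
      let ci  , rest  = ∧₃-valid⁻ (correct Input q) _ (proj₂ correct-quorum q q∈U)
          ce₁ , rest′ = ∧₃-valid⁻ (correct Echo₁ q) _ rest
          ce₂ , _     = ∧₃-valid⁻ (correct Echo₂ q) (correct Output q) rest′
      in ci , ce₁ , ce₂

    input-valid⇒true : ∀ {q} → proj₁ U q → ∀ a → Valid (input q a) → input q a ≡ 𝐭
    input-valid⇒true {q} q∈U = correct-valid⇒true Input q (proj₁ (U-correct q∈U))

    echo₁-valid⇒true : ∀ {q} → proj₁ U q → ∀ a → Valid (echo₁ q a) → echo₁ q a ≡ 𝐭
    echo₁-valid⇒true {q} q∈U = correct-valid⇒true Echo₁ q (proj₁ (proj₂ (U-correct q∈U)))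

    echo₂-valid⇒true : ∀ {q} → proj₁ U q → ∀ a → Valid (echo₂ q a) → echo₂ q a ≡ 𝐭
    echo₂-valid⇒true {q} q∈U = correct-valid⇒true Echo₂ q (proj₂ (proj₂ (U-correct q∈U)))

    input-0-or-1 : ∀ {q} → proj₁ U q → input q v0 ≡ 𝐭 ⊎ input q v1 ≡ 𝐭
    input-0-or-1 {q} q∈U =
      ⊕₃-valid⇒true (input q v0) (input q v1) (proj₁ (∧₃-valid⁻ _ _ (CaInput q)))
        (input-TF v0) (input-TF v1)
      where
      input-TF : ∀ a → Valid (TF₃ (input q a))
      input-TF = correct-valid⁻ Input q (proj₁ (U-correct q∈U))

    echo₁-true : ∀ {q} → proj₁ U q → ∀ a →
                 input q a ≡ 𝐭 ⊎ Contraquorum (Echo₁ a) q ≡ 𝐭 → echo₁ q a ≡ 𝐭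
    echo₁-true {q} q∈U a trigger = echo₁-valid⇒true q∈U a (→w₃-mp echo₁! (∨₃-true⁺ trigger))
      where
      echo₁! : Valid ((input q a ∨₃ Contraquorum (Echo₁ a) q) →w₃ echo₁ q a)
      echo₁! =
        Forall-valid⁻ (λ a → (Input a ∨' Contraquorum (Echo₁ a)) →w' Echo₁ a) q (CaEcho1! q) a

    Quorum-echo₁ : ∀ a → Contraquorum (Echo₁ a) p₀ ≡ 𝐭 → Quorum (Echo₁ a) p₀ ≡ 𝐭
    Quorum-echo₁ a cq = Quorum-true⁺ (Echo₁ a) p₀ U λ q q∈U → echo₁-true q∈U a (inj₂ cq)

    Avoided : Val → Set₁
    Avoided a = Σ OpenNE λ W → ∀ q → proj₁ W q → echo₁ q a ≢ 𝐭

    ¬both-avoided : Avoided v0 → Avoided v1 → ⊥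
    ¬both-avoided (W₀ , avoid₀) (W₁ , avoid₁) with ThreeTwined-meet twined U W₀ W₁
    ... | r , r∈U , r∈W₀ , r∈W₁ with input-0-or-1 r∈U
    ...   | inj₁ input₀ = avoid₀ r r∈W₀ (echo₁-true r∈U v0 (inj₁ input₀))
    ...   | inj₂ input₁ = avoid₁ r r∈W₁ (echo₁-true r∈U v1 (inj₁ input₁))

    echo₁-½-not-true : ∀ r → echo₁ r v½ ≢ 𝐭
    echo₁-½-not-true r echo₁-½
      with Somewhere-true⁻ (Input v½) r
             (→s₃-mp (Forall-valid⁻ (λ a → Echo₁ a →s' Somewhere (Input a)) r (CaEcho1? r) v½)
                     echo₁-½)
    ... | s , input-½ = ¬₃-valid⇒≢𝐭 (proj₂ (∧₃-valid⁻ _ _ (CaInput s))) input-½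

    echo₁-behind-echo₂ : ∀ {q a} → echo₂ q a ≡ 𝐭 →
                         (W : OpenNE) → ∃ λ r → proj₁ W r × echo₁ r a ≡ 𝐭
    echo₁-behind-echo₂ {q} {a} echo₂-a W
      with Quorum-valid⁻ (Echo₁ a) q
             (→w₃-mp (Forall-valid⁻ (λ a → Echo₂ a →w' Quorum (Echo₁ a)) q (CaEcho2? q) a) echo₂-a)
    ... | V , echo₁-on-V with ThreeTwined-meet twined U V W
    ...   | r , r∈U , r∈V , r∈W = r , r∈W , echo₁-valid⇒true r∈U a (echo₁-on-V r r∈V)

    some-echo₂ : ∀ {q} → proj₁ U q → ∀ a → Quorum (Echo₁ a) p₀ ≡ 𝐭 → ∃ λ a′ → echo₂ q a′ ≡ 𝐭
    some-echo₂ {q} q∈U a quorum with ⋁Val-valid⁻ (echo₂ q)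
      (→w₃-mp (CaEcho2! q) (⋁Val-true⁺ (λ a → Quorum (Echo₁ a) q) a quorum))
    ... | a′ , valid = a′ , echo₂-valid⇒true q∈U a′ valid

    Quorum-echo₂ : ∀ a b → (∀ v → v ≡ a ⊎ v ≡ b ⊎ v ≡ v½) →
                   Quorum (Echo₁ a) p₀ ≡ 𝐭 → Avoided b → Quorum (Echo₂ a) p₀ ≡ 𝐭
    Quorum-echo₂ a b cover quorum (W , avoid) = Quorum-true⁺ (Echo₂ a) p₀ U echo₂-a
      where
      echo₂-a : ∀ q → proj₁ U q → echo₂ q a ≡ 𝐭
      echo₂-a q q∈U with some-echo₂ q∈U a quorum
      ... | a′ , echo₂-a′ with cover a′ | echo₁-behind-echo₂ echo₂-a′ W
      ...   | inj₁ refl        | _ = echo₂-a′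
      ...   | inj₂ (inj₁ refl) | r , r∈W , echo₁-b = ⊥-elim (avoid r r∈W echo₁-b)
      ...   | inj₂ (inj₂ refl) | r , _ , echo₁-½ = ⊥-elim (echo₁-½-not-true r echo₁-½)

    output-of-Quorum-echo₂ : ∀ q a → Quorum (Echo₂ a) q ≡ 𝐭 → Valid (output q a)
    output-of-Quorum-echo₂ q a =
      →w₃-mp (Forall-valid⁻ (λ a → Quorum (Echo₂ a) →w' Output a) q (CaOutput! q) a)

    output-of-one-avoided : ∀ a b → (∀ v → v ≡ a ⊎ v ≡ b ⊎ v ≡ v½) → ∀ q →
                            Contraquorum (Echo₁ a) q ≡ 𝐭 → Contraquorum (Echo₁ b) q ≢ 𝐭 →
                            Valid (output q a)
    output-of-one-avoided a b cover q cq-a ¬cq-b =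
      output-of-Quorum-echo₂ q a
        (Quorum-echo₂ a b cover (Quorum-echo₁ a cq-a) (Contraquorum-not-true⁻ (Echo₁ b) q ¬cq-b))

    output-exists : ∀ q → Valid (⋁Val (output q))
    output-exists q
      with lem {P = Contraquorum (Echo₁ v0) q ≡ 𝐭} | lem {P = Contraquorum (Echo₁ v1) q ≡ 𝐭}
    ... | yes cq₀ | yes cq₁ =
      ⋁Val-valid⁺ (output q) v½
        (→w₃-mp (CaOutput'! q) (∧₃-true⁺ (Quorum-echo₁ v0 cq₀) (Quorum-echo₁ v1 cq₁)))
    ... | yes cq₀ | no ¬cq₁ =
      ⋁Val-valid⁺ (output q) v0 (output-of-one-avoided v0 v1 cover₀₁ q cq₀ ¬cq₁)
      where
      cover₀₁ : ∀ v → v ≡ v0 ⊎ v ≡ v1 ⊎ v ≡ v½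
      cover₀₁ v0 = inj₁ refl
      cover₀₁ v1 = inj₂ (inj₁ refl)
      cover₀₁ v½ = inj₂ (inj₂ refl)
    ... | no ¬cq₀ | yes cq₁ =
      ⋁Val-valid⁺ (output q) v1 (output-of-one-avoided v1 v0 cover₁₀ q cq₁ ¬cq₀)
      where
      cover₁₀ : ∀ v → v ≡ v1 ⊎ v ≡ v0 ⊎ v ≡ v½
      cover₁₀ v0 = inj₂ (inj₁ refl)
      cover₁₀ v1 = inj₁ refl
      cover₁₀ v½ = inj₂ (inj₂ refl)
    ... | no ¬cq₀ | no ¬cq₁ =
      ⊥-elim (¬both-avoided (Contraquorum-not-true⁻ (Echo₁ v0) q ¬cq₀)
                            (Contraquorum-not-true⁻ (Echo₁ v1) q ¬cq₁))

proposition5p17 : (lem : ∀ {ℓ} → ExcludedMiddle ℓ) (μ : Model) →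
    ThreeTwined (Model.top μ) →
    Semantics.ThyCA lem μ →
    Semantics.⊨_ lem μ (Semantics.Everywhere lem μ (Semantics.Exists lem μ (Semantics.Output lem μ)))
proposition5p17 lem μ twined thy p = ⋀-valid⁺ lem _ (output-exists lem μ twined thy p)
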